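{- If a function $f:\mathbb{N}\to 3$ is $\Gamma$-hyperimmune relative to $D\subseteq\mathbb{N}$, then $f$ is hyperimmune relative to $D$.
   Context: Hyperimmunity: $f:\mathbb{N}\to3$ is hyperimmune relative to $D$ if for every $D$-computable sequence $(F_{n,0},F_{n,1},F_{n,2})_{n\in\mathbb{N}}$ of triples of mutually disjoint finite sets (given by canonical indices) with $\min\bigcup_{j<3}F_{n,j}>n$, there is $N$ such that $F_{N,j}\subseteq f^{ -1}(j)$ for all $j<3$. $\Gamma$-hyperimmunity. A tree $T_1\subseteq\mathbb{N}^{<\mathbb{N}}$ is a one-step variation of $T_0$ if there are $\xi\in T_0$ and non-empty finite $F\subseteq\mathbb{N}$ with either $\xi$ a leaf of $T_0$ and $T_1=T_0\cup\{\xi\cdot n:n\in F\}$, or $\xi$ not a leaf, $T_1=(T_0\setminus\{\eta:\eta\text{ strictly extends }\xi\})\cup\{\xi\cdot n:n\in F\}$ and $F\subsetneq\{n:\xi\cdot n\in T_0\}$. For a tree-order $(W,\preccurlyeq)$ with root $\zeta$, a computation path on $W$ is a finite sequence $(T_0,\varphi_0),\dots,(T_{u-1},\varphi_{u-1})$ of finite trees with $T_0=\{\varepsilon\}$, each $T_{j+1}$ a one-step variation of $T_j$, and order-preserving maps $\varphi_j:T_j\to W$ with $\varphi_j(\varepsilon)=\zeta$ and $\varphi_{j+1}=\varphi_j$ on $T_{j+1}\cap T_j$. $\Gamma_0$ is the set of finite-domain partial functions $\mathbb{N}\to3$, a depth-one tree with root $\zeta_0$ the empty function and all other elements immediate children of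 the root; $\Gamma_{m+1}$ is the set of computation paths on $\Gamma_m$ ordered by prefix, with root $\zeta_{m+1}=((\{\varepsilon\},\varepsilon\mapsto\zeta_m))$; these are coded computably and have no infinite strictly increasing chains. Interpretation: $[\![\gamma]\!]=\{\gamma\}$ for $\gamma\in\Gamma_0$; for $\gamma=((T_j,\varphi_j))_{j<u}\in\Gamma_{m+1}$, $[\![\gamma]\!]=\bigcup_{\xi\text{ leaf of }T_{u-1}}[\![\varphi_{u-1}(\xi)]\!]$. $\gamma$ is over $n$ if each $h\in[\![\gamma]\!]$ has $\operatorname{dom}h\subseteq(n,\infty)$. A $\Gamma_m$-approximation is $g:\mathbb{N}^2\to\Gamma_m$ with $g(n,0)=\zeta_m$, $s\mapsto g(n,s)$ non-decreasing, and $g(n,s)$ over $n$ for all $n,s$. $f$ is compatible with $\gamma$ if $f$ extends some element of $[\![\gamma]\!]$. $f$ is $\Gamma$-hyperimmune relative to $D$ if for every $m$ and every $D$-computable $\Gamma_m$-approximation $g$ there is $n$ with $f$ compatible with $\lim_s g(n,s)$. -}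

module Defs where

open import Data.Nat using (ℕ; zero; suc; _+_; _*_; _<_; _≤_; _%_; _/_)
open import Data.Bool using (Bool; true; false)
open import Data.Fin using (Fin; toℕ)
open import Data.Vec using (Vec; []; _∷_)
open import Data.List using (List; []; _∷_; _++_; [_]; map)
open import Data.List.Membership.Propositional using (_∈_; _∉_)
open import Data.List.Relation.Unary.Linked using (Linked)
open import Data.Product using (Σ; ∃; _×_; _,_; proj₁)
open import Data.Sum using (_⊎_)
open import Data.Unit using (⊤)
open import Relation.Binary.PropositionalEquality using (_≡_; _≢_)
open import Relation.Nullary using (¬_)

data Prog : ℕ → Set where
  zer  : ∀ {n} → Prog n
  succ : Prog 1
  proj : ∀ {n} → Fin n → Prog n
  orc  : Prog 1
  comp : ∀ {n k} → Prog k → Vec (Prog n) k → Prog n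
  prec : ∀ {n} → Prog n → Prog (suc (suc n)) → Prog (suc n)
  mu   : ∀ {n} → Prog (suc n) → Prog n

χ : Bool → ℕ
χ true  = 1
χ false = 0

lookupV : ∀ {n} → Vec ℕ n → Fin n → ℕ
lookupV (x ∷ xs) Fin.zero    = x
lookupV (x ∷ xs) (Fin.suc i) = lookupV xs i

module _ (D : ℕ → Bool) where
  -- big-step semantics: Eval p xs y  means  p(xs) ↓ = y  (relative to D)
  data Eval : ∀ {n} → Prog n → Vec ℕ n → ℕ → Set
  data EvalVec : ∀ {n k} → Vec (Prog n) k → Vec ℕ n → Vec ℕ k → Set

  data Eval where
    e-zer  : ∀ {n} {xs : Vec ℕ n} → Eval zer xs 0
    e-succ : ∀ {x} → Eval succ (x ∷ []) (suc x)
    e-proj : ∀ {n} {xs : Vec ℕ n} {i} → Eval (proj i) xs (lookupV xs i)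
    e-orc  : ∀ {x} → Eval orc (x ∷ []) (χ (D x))
    e-comp : ∀ {n k} {g : Prog k} {hs : Vec (Prog n) k} {xs ys y} →
             EvalVec hs xs ys → Eval g ys y → Eval (comp g hs) xs y
    e-prec0 : ∀ {n} {g : Prog n} {h} {xs y} →
              Eval g xs y → Eval (prec g h) (0 ∷ xs) y
    e-precS : ∀ {n} {g : Prog n} {h} {xs k r y} →
              Eval (prec g h) (k ∷ xs) r → Eval h (k ∷ r ∷ xs) y →
              Eval (prec g h) (suc k ∷ xs) y
    e-mu   : ∀ {n} {f : Prog (suc n)} {xs y} →
             Eval f (y ∷ xs) 0 →
             (∀ z → z < y → Σ ℕ λ v → Eval f (z ∷ xs) (suc v)) →
             Eval (mu f) xs y

  data EvalVec where
    ev-[] : ∀ {n} {xs : Vec ℕ n} → EvalVec [] xs []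
    ev-∷  : ∀ {n k} {h : Prog n} {hs : Vec (Prog n) k} {xs y ys} →
            Eval h xs y → EvalVec hs xs ys → EvalVec (h ∷ hs) xs (y ∷ ys)

Computable2 : (ℕ → Bool) → (ℕ → ℕ → ℕ) → Set
Computable2 D g = Σ (Prog 2) λ p → ∀ n s → Eval D p (n ∷ s ∷ []) (g n s)

-- Canonical indices of finite sets: k codes {i | bit i of k is 1}.

bitAt : ℕ → ℕ → ℕ
bitAt k zero    = k % 2
bitAt k (suc i) = bitAt (k / 2) i

_∈F_ : ℕ → ℕ → Set
i ∈F k = bitAt k i ≡ 1

-- Hyperimmunity relative to D.  A triple sequence is F : ℕ → Fin 3 → ℕ
-- (canonical indices), D-computable as the function (n , j) ↦ F n j.

Hyperimmune : (ℕ → Bool) → (ℕ → Fin 3) → Set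
Hyperimmune D f =
  (F : ℕ → Fin 3 → ℕ) →
  (Σ (Prog 2) λ p → ∀ n (j : Fin 3) → Eval D p (n ∷ toℕ j ∷ []) (F n j)) →
  (∀ n (j j' : Fin 3) i → j ≢ j' → i ∈F F n j → ¬ (i ∈F F n j')) →
  (∀ n (j : Fin 3) i → i ∈F F n j → n < i) →
  ∃ λ N → ∀ (j : Fin 3) i → i ∈F F N j → f i ≡ j

-- Finite partial functions ℕ → 3, coded bijectively by base-4 digits:
-- digit i of c is 0 ↦ undefined, 1 + j ↦ value j.

digit : ℕ → ℕ → ℕ
digit c zero    = c % 4
digit c (suc i) = digit (c / 4) i

Extends : (ℕ → Fin 3) → ℕ → Set
Extends f h = ∀ i → digit h i ≢ 0 → digit h i ≡ suc (toℕ (f i))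

DomAbove : ℕ → ℕ → Set
DomAbove n h = ∀ i → digit h i ≢ 0 → n < i

-- Finite trees with ℕ-labelled edges and nodes labelled in A:
-- a pair (T , φ : T → A).  Position ξ ∈ ℕ^{<ℕ}.

data LTree (A : Set) : Set where
  node : A → List (ℕ × LTree A) → LTree A

-- At t ξ a : ξ ∈ T and φ(ξ) = a
data At {A : Set} : LTree A → List ℕ → A → Set where
  here  : ∀ {a cs} → At (node a cs) [] a
  there : ∀ {a cs n t ξ b} → (n , t) ∈ cs → At t ξ b → At (node a cs) (n ∷ ξ) b

-- canonical representation: children listed with strictly increasing labels
data Canon {A : Set} : LTree A → Set where
  canon : ∀ {a cs} → Linked _<_ (map proj₁ cs) →
          (∀ {n t} → (n , t) ∈ cs → Canon t) → Canon (node a cs)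

InT : {A : Set} → List ℕ → LTree A → Set
InT {A} ξ t = Σ A λ a → At t ξ a

Leaf : {A : Set} → LTree A → List ℕ → Set
Leaf t ξ = InT ξ t × (∀ n → ¬ InT (ξ ++ [ n ]) t)

_⊏_ : List ℕ → List ℕ → Set
ξ ⊏ η = Σ (List ℕ) λ zs → zs ≢ [] × ξ ++ zs ≡ η

_⇔_ : Set → Set → Set
P ⇔ Q = (P → Q) × (Q → P)

-- one-step variation of trees (on the underlying trees T)
OneStep : {A : Set} → LTree A → LTree A → Set
OneStep t0 t1 = Σ (List ℕ) λ ξ → Σ (List ℕ) λ F → F ≢ [] ×
  ( ( Leaf t0 ξ ×
      (∀ η → InT η t1 ⇔ (InT η t0 ⊎ Σ ℕ λ n → n ∈ F × η ≡ ξ ++ [ n ])))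
  ⊎ ( InT ξ t0 × ¬ Leaf t0 ξ ×
      (∀ n → n ∈ F → InT (ξ ++ [ n ]) t0) ×
      (Σ ℕ λ n → InT (ξ ++ [ n ]) t0 × n ∉ F) ×
      (∀ η → InT η t1 ⇔ ((InT η t0 × ¬ (ξ ⊏ η)) ⊎ Σ ℕ λ n → n ∈ F × η ≡ ξ ++ [ n ]))))

Agree : {A : Set} → LTree A → LTree A → Set
Agree {A} t0 t1 = ∀ η (a b : A) → At t0 η a → At t1 η b → a ≡ b

data Last {A : Set} : List A → A → Set where
  last-here  : ∀ {x} → Last (x ∷ []) x
  last-there : ∀ {y xs x} → Last xs x → Last (y ∷ xs) x

data Chain {A : Set} (R : A → A → Set) : List A → Set where
  ch-[]  : Chain R []
  ch-one : ∀ {x} → Chain R (x ∷ [])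
  ch-∷   : ∀ {x y xs} → R x y → Chain R (y ∷ xs) → Chain R (x ∷ y ∷ xs)

data AllL {A : Set} (P : A → Set) : List A → Set where
  all-[] : AllL P []
  all-∷  : ∀ {x xs} → P x → AllL P xs → AllL P (x ∷ xs)

-- Computation paths on a tree-order (W , ≺ , root), W carved out by Valid
module Paths (W : Set) (_≺_ : W → W → Set) (root : W) (Valid : W → Set) where

  GoodTree : LTree W → Set
  GoodTree t = Canon t
             × At t [] root
             × (∀ ξ a → At t ξ a → Valid a)
             × (∀ ξ η a b → At t ξ a → At t η b → ξ ⊏ η → a ≺ b)

  StepOK : LTree W → LTree W → Set
  StepOK t0 t1 = OneStep t0 t1 × Agree t0 t1

  IsPath : List (LTree W) → Set
  IsPath [] = Data.Empty.⊥ where import Data.Empty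
  IsPath (t ∷ ts) = t ≡ node root [] × AllL GoodTree (t ∷ ts) × Chain StepOK (t ∷ ts)

R : ℕ → Set
R zero    = ℕ                    -- base-4 code of a finite partial function
R (suc m) = List (LTree (R m))   -- a computation path on Γ_m

Le : (m : ℕ) → R m → R m → Set
Le zero    x y = x ≡ 0 ⊎ x ≡ y
Le (suc m) p q = Σ (List (LTree (R m))) λ zs → p ++ zs ≡ q

syntax Le m x y = x ≼[ m ] y

Lt : (m : ℕ) → R m → R m → Set
Lt m x y = Le m x y × x ≢ y

syntax Lt m x y = x ≺[ m ] y

ζ : (m : ℕ) → R m
ζ zero    = 0
ζ (suc m) = node (ζ m) [] ∷ []

IsΓ : (m : ℕ) → R m → Set
IsΓ zero    c = ⊤
IsΓ (suc m) p = Paths.IsPath (R m) (λ x y → x ≺[ m ] y) (ζ m) (IsΓ m) p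

Interp : (m : ℕ) → R m → ℕ → Set
Interp zero    γ h = γ ≡ h
Interp (suc m) p h = Σ (LTree (R m)) λ t → Last p t ×
  Σ (List ℕ) λ ξ → Σ (R m) λ a → At t ξ a × Leaf t ξ × Interp m a h

Over : (m : ℕ) → R m → ℕ → Set
Over m γ n = ∀ h → Interp m γ h → DomAbove n h

Compatible : (ℕ → Fin 3) → (m : ℕ) → R m → Set
Compatible f m γ = Σ ℕ λ h → Interp m γ h × Extends f h

tri : ℕ → ℕ
tri zero    = 0
tri (suc k) = suc k + tri k

pair : ℕ → ℕ → ℕ
pair a b = tri (a + b) + b

module _ {A : Set} (e : A → ℕ) where
  encT  : LTree A → ℕ
  encCs : List (ℕ × LTree A) → ℕ
  encT (node a cs) = pair (e a) (encCs cs)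
  encCs [] = 0
  encCs ((n , t) ∷ cs) = suc (pair (pair n (encT t)) (encCs cs))

encList : {A : Set} → (A → ℕ) → List A → ℕ
encList e [] = 0
encList e (x ∷ xs) = suc (pair (e x) (encList e xs))

enc : (m : ℕ) → R m → ℕ
enc zero    c = c
enc (suc m) p = encList (encT (enc m)) p

IsApprox : (m : ℕ) → (ℕ → ℕ → R m) → Set
IsApprox m g = (∀ n → g n 0 ≡ ζ m)
             × (∀ n s → IsΓ m (g n s))
             × (∀ n s → g n s ≼[ m ] g n (suc s))
             × (∀ n s → Over m (g n s) n)

IsLim : ∀ {m} → (ℕ → R m) → R m → Set
IsLim g γ = Σ ℕ λ s₀ → ∀ s → s₀ ≤ s → g s ≡ γ

ΓHyperimmune : (ℕ → Bool) → (ℕ → Fin 3) → Set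
ΓHyperimmune D f = ∀ (m : ℕ) (g : ℕ → ℕ → R m) → IsApprox m g →
  Computable2 D (λ n s → enc m (g n s)) →
  Σ ℕ λ n → Σ (R m) λ γ → IsLim (g n) γ × Compatible f m γ

{-# OPTIONS --safe #-}
module Submission where

-- A triple of pairwise disjoint finite sets S₀, S₁, S₂ is a finite partial
-- function ℕ → 3 (i ↦ j on Sⱼ), and its base-4 code is computable from the
-- canonical indices by primitive recursion. A D-computable sequence of triples
-- F_n with min F_n > n therefore gives a D-computable Γ₀-approximation: the empty
-- function at stage 0 and the code of F_n from stage 1 on. It is over n, so
-- Γ-hyperimmunity at level 0 yields an N with f extending F_N, i.e.
-- F_{N,j} ⊆ f⁻¹(j) for every j.

open import Defs
open import Data.Nat
open import Data.Nat.Properties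
open import Data.Nat.DivMod
open import Data.Nat.Divisibility using (divides)
open import Data.Bool using (Bool)
open import Data.Fin using (Fin; toℕ)
open import Data.Fin.Patterns using (0F; 1F; 2F)
open import Data.Fin.Properties using (toℕ-injective; toℕ<n; any?)
open import Data.Vec using (Vec; []; _∷_)
open import Data.Product using (∃; _,_)
open import Data.Sum using (inj₁; inj₂)
open import Data.Unit using (tt)
open import Data.Empty using (⊥-elim)
open import Function using (_∘_)
open import Relation.Binary.PropositionalEquality
open import Relation.Nullary using (¬_; Dec; yes; no; contradiction)

bitAt<2 : ∀ k i → bitAt k i < 2
bitAt<2 k zero    = m%n<n k 2
bitAt<2 k (suc i) = bitAt<2 (k / 2) i

bitAt-≥ : ∀ {k i} → k ≤ i → bitAt k i ≡ 0
bitAt-≥ {i = zero}      z≤n       = refl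
bitAt-≥ {zero}  {suc i} _         = bitAt-≥ {0} {i} z≤n
bitAt-≥ {suc k} {suc i} (s≤s k≤i) =
  bitAt-≥ {suc k / 2} (≤-trans (s≤s⁻¹ (m/n<m (suc k) 2 (s≤s (s≤s z≤n)))) k≤i)

∈F⇒< : ∀ {i k} → i ∈F k → i < k
∈F⇒< i∈k = ≰⇒> λ k≤i → 0≢1+n (trans (sym (bitAt-≥ k≤i)) i∈k)

∉F⇒≡0 : ∀ {k} i → ¬ i ∈F k → bitAt k i ≡ 0
∉F⇒≡0 {k} i i∉k with bitAt k i | bitAt<2 k i
... | 0 | _ = refl
... | 1 | _ = contradiction refl i∉k
... | 2+ _ | s≤s (s≤s ())

_∈F?_ : ∀ i k → Dec (i ∈F k)
i ∈F? k = bitAt k i ≟ 1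

-- Primitive-recursive forms of _% 2, _/ 2 and iterated halving, through which
-- a program computes bitAt.

isZero : ℕ → ℕ
isZero zero    = 1
isZero (suc _) = 0

mod2 : ℕ → ℕ
mod2 zero    = 0
mod2 (suc x) = isZero (mod2 x)

half : ℕ → ℕ
half zero    = 0
half (suc x) = half x + mod2 x

halvings : ℕ → ℕ → ℕ
halvings zero    k = k
halvings (suc i) k = half (halvings i k)

isZero-isZero-isZero : ∀ b → isZero (isZero (isZero b)) ≡ isZero b
isZero-isZero-isZero zero    = refl
isZero-isZero-isZero (suc _) = refl

isZero+isZero-isZero : ∀ b → isZero b + isZero (isZero b) ≡ 1
isZero+isZero-isZero zero    = refl
isZero+isZero-isZero (suc _) = refl

mod2-suc-suc : ∀ x → mod2 (suc (suc x)) ≡ mod2 x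
mod2-suc-suc zero    = refl
mod2-suc-suc (suc x) = isZero-isZero-isZero (mod2 x)

mod2+mod2-suc : ∀ x → mod2 x + mod2 (suc x) ≡ 1
mod2+mod2-suc zero    = refl
mod2+mod2-suc (suc x) = isZero+isZero-isZero (mod2 x)

mod2≡%2 : ∀ x → mod2 x ≡ x % 2
mod2≡%2 zero          = refl
mod2≡%2 (suc zero)    = refl
mod2≡%2 (suc (suc x)) = trans (mod2-suc-suc x) (mod2≡%2 x)

half-suc-suc : ∀ x → half (suc (suc x)) ≡ suc (half x)
half-suc-suc x = begin
  half x + mod2 x + mod2 (suc x)   ≡⟨ +-assoc (half x) _ _ ⟩
  half x + (mod2 x + mod2 (suc x)) ≡⟨ cong (half x +_) (mod2+mod2-suc x) ⟩
  half x + 1                       ≡⟨ +-comm (half x) 1 ⟩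
  suc (half x)                     ∎
  where open ≡-Reasoning

half≡/2 : ∀ x → half x ≡ x / 2
half≡/2 zero          = refl
half≡/2 (suc zero)    = refl
half≡/2 (suc (suc x)) = begin
  half (suc (suc x)) ≡⟨ half-suc-suc x ⟩
  suc (half x)       ≡⟨ cong suc (half≡/2 x) ⟩
  suc (x / 2)        ≡⟨ sym (m/n≡1+[m∸n]/n {suc (suc x)} {2} (s≤s (s≤s z≤n))) ⟩
  suc (suc x) / 2    ∎
  where open ≡-Reasoning

halvings-half : ∀ i k → halvings i (half k) ≡ half (halvings i k)
halvings-half zero    k = refl
halvings-half (suc i) k = cong half (halvings-half i k)

mod2-halvings : ∀ i k → mod2 (halvings i k) ≡ bitAt k i
mod2-halvings zero    k = mod2≡%2 k
mod2-halvings (suc i) k = begin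
  mod2 (half (halvings i k)) ≡⟨ cong mod2 (sym (halvings-half i k)) ⟩
  mod2 (halvings i (half k)) ≡⟨ cong (mod2 ∘ halvings i) (half≡/2 k) ⟩
  mod2 (halvings i (k / 2))  ≡⟨ mod2-halvings i (k / 2) ⟩
  bitAt (k / 2) i            ∎
  where open ≡-Reasoning

4^suc*-comm : ∀ t e → 4 ^ suc t * e ≡ 4 ^ t * e * 4
4^suc*-comm t e = trans (*-assoc 4 (4 ^ t) e) (*-comm 4 (4 ^ t * e))

shift-/4 : ∀ a t e → (a + 4 ^ suc t * e) / 4 ≡ a / 4 + 4 ^ t * e
shift-/4 a t e rewrite 4^suc*-comm t e =
  trans (+-distrib-/-∣ʳ a (divides (4 ^ t * e) refl)) (cong (a / 4 +_) (m*n/n≡m (4 ^ t * e) 4))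

shift-%4 : ∀ a t e → (a + 4 ^ suc t * e) % 4 ≡ a % 4
shift-%4 a t e rewrite 4^suc*-comm t e = [m+kn]%n≡m%n a (4 ^ t * e) 4

/4<4^ : ∀ {a} t → a < 4 ^ suc t → a / 4 < 4 ^ t
/4<4^ {a} t a<4^ = m<n*o⇒m/o<n (subst (a <_) (*-comm 4 (4 ^ t)) a<4^)

digit-<4^ : ∀ {a} i → a < 4 ^ i → digit a i ≡ 0
digit-<4^ zero    (s≤s z≤n) = refl
digit-<4^ (suc i) a<4^      = digit-<4^ i (/4<4^ i a<4^)

digit-+-low : ∀ {a} t e {i} → a < 4 ^ t → i < t → digit (a + 4 ^ t * e) i ≡ digit a i
digit-+-low {a} (suc t) e {zero}  _    _         = shift-%4 a t e
digit-+-low {a} (suc t) e {suc i} a<4^ (s≤s i<t) =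
  trans (cong (λ x → digit x i) (shift-/4 a t e)) (digit-+-low t e (/4<4^ t a<4^) i<t)

digit-+-top : ∀ {a} t e → a < 4 ^ t → digit (a + 4 ^ t * e) t ≡ digit e 0
digit-+-top     zero    e (s≤s z≤n) = cong (_% 4) (+-identityʳ e)
digit-+-top {a} (suc t) e a<4^      =
  trans (cong (λ x → digit x t) (shift-/4 a t e)) (digit-+-top t e (/4<4^ t a<4^))

fromDigits : (ℕ → ℕ) → ℕ → ℕ
fromDigits d zero    = 0
fromDigits d (suc t) = fromDigits d t + 4 ^ t * d t

module _ {d : ℕ → ℕ} (d<4 : ∀ i → d i < 4) where

  fromDigits<4^ : ∀ t → fromDigits d t < 4 ^ t
  fromDigits<4^ zero    = s≤s z≤n
  fromDigits<4^ (suc t) = begin-strict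
    fromDigits d t + 4 ^ t * d t
      <⟨ +-mono-<-≤ (fromDigits<4^ t) (*-monoʳ-≤ (4 ^ t) (s≤s⁻¹ (d<4 t))) ⟩
    4 ^ t + 4 ^ t * 3            ≡⟨ cong (4 ^ t +_) (*-comm (4 ^ t) 3) ⟩
    4 ^ suc t                    ∎
    where open ≤-Reasoning

  digit-fromDigits : ∀ {t i} → i < t → digit (fromDigits d t) i ≡ d i
  digit-fromDigits {suc t} i<1+t with m<1+n⇒m<n∨m≡n i<1+t
  ... | inj₁ i<t  = trans (digit-+-low t (d t) (fromDigits<4^ t) i<t) (digit-fromDigits i<t)
  ... | inj₂ refl = trans (digit-+-top t (d t) (fromDigits<4^ t)) (m<n⇒m%n≡m (d<4 t))

  digit-fromDigits-≥ : ∀ {t i} → t ≤ i → digit (fromDigits d t) i ≡ 0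
  digit-fromDigits-≥ {t} {i} t≤i =
    digit-<4^ i (<-≤-trans (fromDigits<4^ t) (^-monoʳ-≤ 4 t≤i))

Disjoint : (Fin 3 → ℕ) → Set
Disjoint S = ∀ j j' i → j ≢ j' → i ∈F S j → ¬ (i ∈F S j')

-- For disjoint Sⱼ at most one bit is set, so this is 1 + j on Sⱼ and 0 off
-- S₀ ∪ S₁ ∪ S₂: the base-4 digit at i of the partial function i ↦ j.
cellDigit : (Fin 3 → ℕ) → ℕ → ℕ
cellDigit S i = bitAt (S 0F) i + 2 * bitAt (S 1F) i + 3 * bitAt (S 2F) i

cellDigit-bits : ∀ S i {x y z} →
                 bitAt (S 0F) i ≡ x → bitAt (S 1F) i ≡ y → bitAt (S 2F) i ≡ z →
                 cellDigit S i ≡ x + 2 * y + 3 * z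
cellDigit-bits S i refl refl refl = refl

cellDigit-∉ : ∀ {S} i → (∀ j → ¬ i ∈F S j) → cellDigit S i ≡ 0
cellDigit-∉ {S} i i∉ = cellDigit-bits S i (bit≡0 0F) (bit≡0 1F) (bit≡0 2F)
  where
  bit≡0 : ∀ j → bitAt (S j) i ≡ 0
  bit≡0 j = ∉F⇒≡0 i (i∉ j)

disjoint-bit≡0 : ∀ {S} → Disjoint S → ∀ {j} i → i ∈F S j → ∀ j' → j ≢ j' → bitAt (S j') i ≡ 0
disjoint-bit≡0 disj {j} i i∈ j' j≢j' = ∉F⇒≡0 i (disj j j' i j≢j' i∈)

cellDigit-∈ : ∀ {S} → Disjoint S → ∀ j i → i ∈F S j → cellDigit S i ≡ suc (toℕ j)
cellDigit-∈ {S} disj 0F i i∈ =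
  cellDigit-bits S i i∈ (disjoint-bit≡0 disj i i∈ 1F λ ()) (disjoint-bit≡0 disj i i∈ 2F λ ())
cellDigit-∈ {S} disj 1F i i∈ =
  cellDigit-bits S i (disjoint-bit≡0 disj i i∈ 0F λ ()) i∈ (disjoint-bit≡0 disj i i∈ 2F λ ())
cellDigit-∈ {S} disj 2F i i∈ =
  cellDigit-bits S i (disjoint-bit≡0 disj i i∈ 0F λ ()) (disjoint-bit≡0 disj i i∈ 1F λ ()) i∈

cellDigit≢0⇒∈ : ∀ {S} i → cellDigit S i ≢ 0 → ∃ λ j → i ∈F S j
cellDigit≢0⇒∈ {S} i ≢0 with any? (λ j → i ∈F? S j)
... | yes i∈ = i∈
... | no  i∉ = ⊥-elim (≢0 (cellDigit-∉ i λ j i∈ → i∉ (j , i∈)))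

cellDigit<4 : ∀ {S} → Disjoint S → ∀ i → cellDigit S i < 4
cellDigit<4 {S} disj i with any? (λ j → i ∈F? S j)
... | yes (j , i∈) = subst (_< 4) (sym (cellDigit-∈ disj j i i∈)) (s≤s (toℕ<n j))
... | no  i∉       = subst (_< 4) (sym (cellDigit-∉ i λ j i∈ → i∉ (j , i∈))) (s≤s z≤n)

bound : (Fin 3 → ℕ) → ℕ
bound S = S 0F + S 1F + S 2F

≤-bound : ∀ S j → S j ≤ bound S
≤-bound S 0F = ≤-trans (m≤m+n (S 0F) (S 1F)) (m≤m+n (S 0F + S 1F) (S 2F))
≤-bound S 1F = ≤-trans (m≤n+m (S 1F) (S 0F)) (m≤m+n (S 0F + S 1F) (S 2F))
≤-bound S 2F = m≤n+m (S 2F) (S 0F + S 1F)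

encode : (Fin 3 → ℕ) → ℕ
encode S = fromDigits (cellDigit S) (bound S)

digit-encode : ∀ {S} → Disjoint S → ∀ i → digit (encode S) i ≡ cellDigit S i
digit-encode {S} disj i with i <? bound S
... | yes i<b = digit-fromDigits (cellDigit<4 disj) i<b
... | no  i≮b = trans (digit-fromDigits-≥ (cellDigit<4 disj) (≮⇒≥ i≮b))
                      (sym (cellDigit-∉ i λ j i∈ → i≮b (<-≤-trans (∈F⇒< i∈) (≤-bound S j))))

encode-domAbove : ∀ {S n} → Disjoint S → (∀ j i → i ∈F S j → n < i) →
                  DomAbove n (encode S)
encode-domAbove disj above i ≢0
  with cellDigit≢0⇒∈ i (≢0 ∘ trans (digit-encode disj i))
... | j , i∈ = above j i i∈

extends-encode : ∀ {f S} → Disjoint S → Extends f (encode S) →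
                 ∀ j i → i ∈F S j → f i ≡ j
extends-encode {f} {S} disj f⊇S j i i∈ =
  toℕ-injective (suc-injective (trans (sym (f⊇S i digit≢0)) digit≡))
  where
  digit≡ : digit (encode S) i ≡ suc (toℕ j)
  digit≡ = trans (digit-encode disj i) (cellDigit-∈ disj j i i∈)
  digit≢0 : digit (encode S) i ≢ 0
  digit≢0 eq = 0≢1+n (trans (sym eq) digit≡)

approx : (ℕ → Fin 3 → ℕ) → ℕ → ℕ → R 0
approx F n zero    = ζ 0
approx F n (suc s) = encode (F n)

approx-isApprox : ∀ {F} → (∀ n → Disjoint (F n)) → (∀ n j i → i ∈F F n j → n < i) →
                  IsApprox 0 (approx F)
approx-isApprox {F} disj above = (λ _ → refl) , (λ _ _ → tt) , mono , over
  where
  mono : ∀ n s → approx F n s ≼[ 0 ] approx F n (suc s)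
  mono n zero    = inj₁ refl
  mono n (suc s) = inj₂ refl
  over : ∀ n s → Over 0 (approx F n s) n
  over n zero    _ refl i ≢0 = ⊥-elim (≢0 (digit-<4^ i (m^n>0 4 i)))
  over n (suc s) _ refl      = encode-domAbove (disj n) (above n)

approx-lim : ∀ {F n γ} → IsLim (approx F n) γ → encode (F n) ≡ γ
approx-lim (s₀ , lim) = lim (suc s₀) (n≤1+n s₀)

infixl 6 _+P_
infixl 7 _*P_

constP : ∀ {n} → ℕ → Prog n
constP zero    = zer
constP (suc k) = comp succ (constP k ∷ [])

addP : Prog 2
addP = prec (proj 0F) (comp succ (proj 1F ∷ []))

_+P_ : ∀ {n} → Prog n → Prog n → Prog n
p +P q = comp addP (p ∷ q ∷ [])

mulP : Prog 2
mulP = prec zer (proj 2F +P proj 1F)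

_*P_ : ∀ {n} → Prog n → Prog n → Prog n
p *P q = comp mulP (p ∷ q ∷ [])

pow4P : Prog 1
pow4P = prec (constP 1) (constP 4 *P proj 1F)

isZeroP : Prog 1
isZeroP = prec (constP 1) zer

mod2P : Prog 1
mod2P = prec zer (comp isZeroP (proj 1F ∷ []))

halfP : Prog 1
halfP = prec zer (proj 1F +P comp mod2P (proj 0F ∷ []))

halvingsP : Prog 2
halvingsP = prec (proj 0F) (comp halfP (proj 1F ∷ []))

bitAtP : Prog 2
bitAtP = comp mod2P (halvingsP ∷ [])

fromDigitsP : Prog 2 → Prog 2
fromDigitsP q =
  prec zer (proj 1F +P comp pow4P (proj 0F ∷ []) *P comp q (proj 0F ∷ proj 2F ∷ []))

module _ (p : Prog 2) where

  memberP : Fin 3 → Prog 1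
  memberP j = comp p (proj 0F ∷ constP (toℕ j) ∷ [])

  bitP : Fin 3 → Prog 2
  bitP j = comp bitAtP (proj 0F ∷ comp (memberP j) (proj 1F ∷ []) ∷ [])

  cellDigitP : Prog 2
  cellDigitP = bitP 0F +P constP 2 *P bitP 1F +P constP 3 *P bitP 2F

  boundP : Prog 1
  boundP = memberP 0F +P memberP 1F +P memberP 2F

  encodeP : Prog 1
  encodeP = comp (fromDigitsP cellDigitP) (boundP ∷ proj 0F ∷ [])

  approxP : Prog 2
  approxP = comp (prec zer (comp encodeP (proj 2F ∷ []))) (proj 1F ∷ proj 0F ∷ [])

module _ (D : ℕ → Bool) where

  eval-comp₁ : ∀ {n} {g : Prog 1} {h : Prog n} {xs a y} →
               Eval D g (a ∷ []) y → Eval D h xs a → Eval D (comp g (h ∷ [])) xs y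
  eval-comp₁ eg eh = e-comp (ev-∷ eh ev-[]) eg

  eval-comp₂ : ∀ {n} {g : Prog 2} {h₁ h₂ : Prog n} {xs a b y} → Eval D g (a ∷ b ∷ []) y →
               Eval D h₁ xs a → Eval D h₂ xs b → Eval D (comp g (h₁ ∷ h₂ ∷ [])) xs y
  eval-comp₂ eg e₁ e₂ = e-comp (ev-∷ e₁ (ev-∷ e₂ ev-[])) eg

  eval-prec : ∀ {n} {g : Prog n} {h : Prog (suc (suc n))} {xs : Vec ℕ n} (u : ℕ → ℕ) →
              Eval D g xs (u 0) → (∀ t → Eval D h (t ∷ u t ∷ xs) (u (suc t))) →
              ∀ k → Eval D (prec g h) (k ∷ xs) (u k)
  eval-prec u base step zero    = e-prec0 base
  eval-prec u base step (suc k) = e-precS (eval-prec u base step k) (step k)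

  eval-const : ∀ {n} {xs : Vec ℕ n} k → Eval D (constP k) xs k
  eval-const zero    = e-zer
  eval-const (suc k) = eval-comp₁ e-succ (eval-const k)

  eval-add : ∀ a b → Eval D addP (a ∷ b ∷ []) (a + b)
  eval-add a b = eval-prec (_+ b) e-proj (λ _ → eval-comp₁ e-succ e-proj) a

  eval-+P : ∀ {n} {p q : Prog n} {xs a b} →
            Eval D p xs a → Eval D q xs b → Eval D (p +P q) xs (a + b)
  eval-+P = eval-comp₂ (eval-add _ _)

  eval-mul : ∀ a b → Eval D mulP (a ∷ b ∷ []) (a * b)
  eval-mul a b = eval-prec (_* b) e-zer (λ _ → eval-+P e-proj e-proj) a

  eval-*P : ∀ {n} {p q : Prog n} {xs a b} →
            Eval D p xs a → Eval D q xs b → Eval D (p *P q) xs (a * b)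
  eval-*P = eval-comp₂ (eval-mul _ _)

  eval-pow4 : ∀ t → Eval D pow4P (t ∷ []) (4 ^ t)
  eval-pow4 = eval-prec (4 ^_) (eval-const 1) (λ _ → eval-*P (eval-const 4) e-proj)

  eval-isZero : ∀ x → Eval D isZeroP (x ∷ []) (isZero x)
  eval-isZero = eval-prec isZero (eval-const 1) (λ _ → e-zer)

  eval-mod2 : ∀ x → Eval D mod2P (x ∷ []) (mod2 x)
  eval-mod2 = eval-prec mod2 e-zer (λ t → eval-comp₁ (eval-isZero (mod2 t)) e-proj)

  eval-half : ∀ x → Eval D halfP (x ∷ []) (half x)
  eval-half = eval-prec half e-zer (λ t → eval-+P e-proj (eval-comp₁ (eval-mod2 t) e-proj))

  eval-halvings : ∀ i k → Eval D halvingsP (i ∷ k ∷ []) (halvings i k)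
  eval-halvings i k =
    eval-prec (λ i → halvings i k) e-proj
              (λ t → eval-comp₁ (eval-half (halvings t k)) e-proj) i

  eval-bitAt : ∀ i k → Eval D bitAtP (i ∷ k ∷ []) (bitAt k i)
  eval-bitAt i k = subst (Eval D bitAtP (i ∷ k ∷ [])) (mod2-halvings i k)
    (eval-comp₁ (eval-mod2 (halvings i k)) (eval-halvings i k))

  eval-fromDigits : ∀ {q} (d : ℕ → ℕ → ℕ) → (∀ i n → Eval D q (i ∷ n ∷ []) (d n i)) →
                    ∀ t n → Eval D (fromDigitsP q) (t ∷ n ∷ []) (fromDigits (d n) t)
  eval-fromDigits d eval-q t n = eval-prec (fromDigits (d n)) e-zer
    (λ t → eval-+P e-proj (eval-*P (eval-comp₁ (eval-pow4 t) e-proj)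
                                   (eval-comp₂ (eval-q t n) e-proj e-proj)))
    t

  module _ {F : ℕ → Fin 3 → ℕ} {p : Prog 2}
           (eval-p : ∀ n j → Eval D p (n ∷ toℕ j ∷ []) (F n j)) where

    eval-member : ∀ j n → Eval D (memberP p j) (n ∷ []) (F n j)
    eval-member j n = eval-comp₂ (eval-p n j) e-proj (eval-const (toℕ j))

    eval-bit : ∀ j i n → Eval D (bitP p j) (i ∷ n ∷ []) (bitAt (F n j) i)
    eval-bit j i n =
      eval-comp₂ (eval-bitAt i (F n j)) e-proj (eval-comp₁ (eval-member j n) e-proj)

    eval-cellDigit : ∀ i n → Eval D (cellDigitP p) (i ∷ n ∷ []) (cellDigit (F n) i)
    eval-cellDigit i n =
      eval-+P (eval-+P (eval-bit 0F i n) (eval-*P (eval-const 2) (eval-bit 1F i n)))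
              (eval-*P (eval-const 3) (eval-bit 2F i n))

    eval-bound : ∀ n → Eval D (boundP p) (n ∷ []) (bound (F n))
    eval-bound n = eval-+P (eval-+P (eval-member 0F n) (eval-member 1F n)) (eval-member 2F n)

    eval-encode : ∀ n → Eval D (encodeP p) (n ∷ []) (encode (F n))
    eval-encode n =
      eval-comp₂ (eval-fromDigits (cellDigit ∘ F) eval-cellDigit (bound (F n)) n)
                 (eval-bound n) e-proj

    approx-computable : Computable2 D (λ n s → enc 0 (approx F n s))
    approx-computable = approxP p , λ n s →
      eval-comp₂ (eval-prec (approx F n) e-zer (λ _ → eval-comp₁ (eval-encode n) e-proj) s)
                 e-proj e-proj

mainTheorem8 : (D : ℕ → Bool) (f : ℕ → Fin 3) → ΓHyperimmune D f → Hyperimmune D f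
mainTheorem8 D f ΓH F (p , eval-p) disjoint above
  with ΓH 0 (approx F) (approx-isApprox disjoint above) (approx-computable D eval-p)
... | N , γ , lim , (h , refl , f⊇h) =
  N , extends-encode (disjoint N) (subst (Extends f) (sym (approx-lim lim)) f⊇h)
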